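{- Alice wins every canonical ESD labeling game on a star $S_n=K_{1,n-1}$, regardless of how the players play.
   Context: For a graph $G=(V,E)$ and $l\in\mathbb N$, a vertex labeling $\phi:V\to\{1,\dots,l\}$ is an edge-sum distinguishing (ESD) labeling if $\phi$ is injective and the edge-weights $w_\phi(uv)=\phi(u)+\phi(v)$ are pairwise distinct over all edges $uv\in E$. ESD labeling game on $G$ with label set $L=\{1,\dots,l\}$: Alice and Bob alternate moves, Alice starting. In each move the player chooses a not-yet-labeled vertex and assigns to it a label from $L$ not used before; the move is legal if the edge-weights of edges with both endpoints labeled remain pairwise distinct. The game ends when no legal move is possible or an ESD labeling of $G$ is created; Alice wins if an ESD labeling is created, otherwise Bob wins. The game is canonical if $|L|=|V(G)|$. -}

module Defs where

open import Data.Nat using (ℕ; zero; suc; _+_; _≤_)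
open import Data.Fin using (Fin; zero; suc)
open import Data.List using (List; []; map; length; lookup; allFin)
open import Data.Maybe using (Maybe; just; nothing)
open import Data.Product using (_×_; _,_; proj₁; proj₂; ∃; ∃-syntax)
open import Relation.Binary.PropositionalEquality using (_≡_; _≢_)
open import Relation.Nullary using (¬_)

record Graph : Set where
  constructor mkGraph
  field
    V : ℕ
    E : List (Fin V × Fin V)

open Graph public

edge : (G : Graph) → Fin (length (E G)) → Fin (V G) × Fin (V G)
edge G i = lookup (E G) i

IsESD : (G : Graph) → (l : ℕ) → (Fin (V G) → ℕ) → Set
IsESD G l φ =
  (∀ v → 1 ≤ φ v × φ v ≤ l) ×
  (∀ u v → φ u ≡ φ v → u ≡ v) ×
  (∀ i j → i ≢ j →
     φ (proj₁ (edge G i)) + φ (proj₂ (edge G i))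
       ≢ φ (proj₁ (edge G j)) + φ (proj₂ (edge G j)))

-- Partial labelings (game positions): nothing = not yet labeled.
PLabel : Graph → Set
PLabel G = Fin (V G) → Maybe ℕ

emptyLabel : (G : Graph) → PLabel G
emptyLabel G v = nothing

DistinctWeights : (G : Graph) → PLabel G → Set
DistinctWeights G p =
  ∀ i j → i ≢ j → ∀ a b c d →
    p (proj₁ (edge G i)) ≡ just a → p (proj₂ (edge G i)) ≡ just b →
    p (proj₁ (edge G j)) ≡ just c → p (proj₂ (edge G j)) ≡ just d →
    a + b ≢ c + d

Move : (G : Graph) → (l : ℕ) → PLabel G → PLabel G → Set
Move G l p p' =
  ∃[ v ] ∃[ a ]
    (p v ≡ nothing) ×
    (1 ≤ a × a ≤ l) ×
    (∀ u → p u ≢ just a) ×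
    (p' v ≡ just a) ×
    (∀ u → u ≢ v → p' u ≡ p u) ×
    DistinctWeights G p'

-- Positions reachable from the empty labeling by a sequence of legal moves
-- (by either player, in any manner of play).
data Reachable (G : Graph) (l : ℕ) : PLabel G → Set where
  start : Reachable G l (emptyLabel G)
  step  : ∀ {p p'} → Reachable G l p → Move G l p p' → Reachable G l p'

-- Alice wins regardless of how the players play: every reachable position
-- in which no legal move is possible is a (complete) ESD labeling.
-- (A game stopped earlier because an ESD labeling was created is also a win.)
AliceAlwaysWins : (G : Graph) → (l : ℕ) → Set
AliceAlwaysWins G l =
  ∀ p → Reachable G l p → (∀ p' → ¬ Move G l p p') →
    ∃[ φ ] (IsESD G l φ × (∀ v → p v ≡ just (φ v)))

star : ℕ → Graph
star zero    = mkGraph zero []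
star (suc m) = mkGraph (suc m) (map (λ i → (zero , suc i)) (allFin m))

module Submission where

-- On a star every edge contains the centre, so two edges have equal
-- weight only if their leaves carry equal labels.  Hence on a star *every*
-- injective partial labeling has pairwise distinct edge weights, and the only
-- rule of the game that can ever block a move is "labels are not reused".
-- With |L| = |V| labels, an unlabeled vertex always leaves a label free
-- (pigeonhole), so the game can only stop once every vertex is labeled, and
-- the final position is an ESD labeling.

open import Defs
open import Data.Nat using (ℕ; suc; _+_; _≤_; s≤s; z≤n)
open import Data.Nat.Properties using (+-cancelˡ-≡; suc-injective; ≤-refl)
  renaming (_≟_ to _≟ℕ_)
open import Data.Fin using (Fin; zero; suc; toℕ; punchOut)
open import Data.Fin.Properties
  using (toℕ-injective; toℕ<n; any?; ¬∀⟶∃¬; pigeonhole; punchOut-injective; <⇒≢)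
  renaming (_≟_ to _≟F_; suc-injective to Fin-suc-injective)
open import Data.List using (map; length; lookup; tabulate)
open import Data.Maybe using (Maybe; just; nothing)
open import Data.Maybe.Properties using (just-injective) renaming (≡-dec to Maybe-≟)
open import Data.Product using (_×_; _,_; proj₁; proj₂; ∃-syntax)
open import Data.Empty using (⊥-elim)
open import Relation.Binary.PropositionalEquality
  using (_≡_; _≢_; refl; sym; trans; cong; subst)
open import Relation.Nullary using (¬_; Dec; yes; no)
open import Function using (id; _∘_)

LabelInjective : ∀ {n} → (Fin n → Maybe ℕ) → Set
LabelInjective p = ∀ u w a → p u ≡ just a → p w ≡ just a → u ≡ w

LabelsInRange : ∀ {n} → ℕ → (Fin n → Maybe ℕ) → Set
LabelsInRange l p = ∀ v a → p v ≡ just a → 1 ≤ a × a ≤ l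

assign : ∀ {n} → (Fin n → Maybe ℕ) → Fin n → ℕ → Fin n → Maybe ℕ
assign p v a u with u ≟F v
... | yes _ = just a
... | no  _ = p u

assign-here : ∀ {n} (p : Fin n → Maybe ℕ) v a → assign p v a v ≡ just a
assign-here p v a with v ≟F v
... | yes _   = refl
... | no  v≢v = ⊥-elim (v≢v refl)

assign-elsewhere : ∀ {n} (p : Fin n → Maybe ℕ) v a u → u ≢ v → assign p v a u ≡ p u
assign-elsewhere p v a u u≢v with u ≟F v
... | yes u≡v = ⊥-elim (u≢v u≡v)
... | no  _   = refl

extend-injective : ∀ {n} (p p' : Fin n → Maybe ℕ) v a →
  LabelInjective p → (∀ u → p u ≢ just a) →
  p' v ≡ just a → (∀ u → u ≢ v → p' u ≡ p u) → LabelInjective p'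
extend-injective p p' v a inj unused p'v others u w b p'u p'w
  with u ≟F v | w ≟F v
... | yes refl | yes refl = refl
... | yes refl | no  w≢v =
  ⊥-elim (unused w (trans (sym (others w w≢v)) (trans p'w (trans (sym p'u) p'v))))
... | no  u≢v  | yes refl =
  ⊥-elim (unused u (trans (sym (others u u≢v)) (trans p'u (trans (sym p'w) p'v))))
... | no  u≢v  | no  w≢v  =
  inj u w b (trans (sym (others u u≢v)) p'u) (trans (sym (others w w≢v)) p'w)

Valid : (G : Graph) → ℕ → PLabel G → Set
Valid G l p = LabelsInRange l p × LabelInjective p × DistinctWeights G p

reachable-valid : ∀ G l p → Reachable G l p → Valid G l p
reachable-valid G l _ start =
  (λ _ _ ()) , (λ _ _ _ ()) , (λ _ _ _ _ _ _ _ ())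
reachable-valid G l p (step {q} r (v , a , _ , a∈L , unused , p'v , others , dw)) =
  in-range , extend-injective q p v a q-inj unused p'v others , dw
  where
  q-valid : Valid G l q
  q-valid = reachable-valid G l q r
  q-inj : LabelInjective q
  q-inj = proj₁ (proj₂ q-valid)
  in-range : LabelsInRange l p
  in-range u b pu≡b with u ≟F v
  ... | yes refl = subst (λ x → 1 ≤ x × x ≤ l) (just-injective (trans (sym p'v) pu≡b)) a∈L
  ... | no  u≢v  = proj₁ q-valid u b (trans (sym (others u u≢v)) pu≡b)

complete-valid-is-ESD : ∀ G l (p : PLabel G) → Valid G l p →
  (labels : ∀ v → ∃[ a ] (p v ≡ just a)) → IsESD G l (proj₁ ∘ labels)
complete-valid-is-ESD G l p (in-range , inj , dw) labels =
  (λ v → in-range v (φ v) (φ-spec v)) ,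
  (λ u v φu≡φv → inj u v (φ u) (φ-spec u) (trans (φ-spec v) (cong just (sym φu≡φv)))) ,
  (λ i j i≢j → dw i j i≢j _ _ _ _ (φ-spec _) (φ-spec _) (φ-spec _) (φ-spec _))
  where
  φ : Fin (V G) → ℕ
  φ = proj₁ ∘ labels
  φ-spec : ∀ v → p v ≡ just (φ v)
  φ-spec = proj₂ ∘ labels

Used : ∀ {n} → (Fin n → Maybe ℕ) → ℕ → Set
Used p a = ∃[ u ] (p u ≡ just a)

-- If n ≤ l and vertex v is unlabeled, an injective labeling cannot use all of
-- 1,…,l: the carriers of these l labels would be l distinct vertices ≠ v.
not-all-used : ∀ {n l} (p : Fin n → Maybe ℕ) → n ≤ l → LabelInjective p →
  (v : Fin n) → p v ≡ nothing → ¬ (∀ (a : Fin l) → Used p (suc (toℕ a)))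
not-all-used {suc k} p k<l inj v pv≡nothing all-used =
  let a , b , a<b , same-squeeze = pigeonhole k<l squeeze
  in <⇒≢ a<b (carrier-injective a b
       (punchOut-injective (carrier≢v a) (carrier≢v b) same-squeeze))
  where
  carrier : Fin _ → Fin (suc k)
  carrier a = proj₁ (all-used a)
  carrier≢v : ∀ a → v ≢ carrier a
  carrier≢v a v≡c with trans (sym pv≡nothing) (trans (cong p v≡c) (proj₂ (all-used a)))
  ... | ()
  -- the carriers avoid v, so they live in a set of k < l vertices
  squeeze : Fin _ → Fin k
  squeeze a = punchOut (carrier≢v a)
  carrier-injective : ∀ a b → carrier a ≡ carrier b → a ≡ b
  carrier-injective a b same = toℕ-injective (suc-injective (just-injective
    (trans (sym (proj₂ (all-used a))) (trans (cong p same) (proj₂ (all-used b))))))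

free-label : ∀ {n l} (p : Fin n → Maybe ℕ) → n ≤ l → LabelInjective p →
  (v : Fin n) → p v ≡ nothing → ∃[ a ] ((1 ≤ a × a ≤ l) × (∀ u → p u ≢ just a))
free-label {l = l} p n≤l inj v pv≡nothing
  with ¬∀⟶∃¬ l _ used? (not-all-used p n≤l inj v pv≡nothing)
  where
  used? : ∀ (a : Fin l) → Dec (Used p (suc (toℕ a)))
  used? a = any? (λ u → Maybe-≟ _≟ℕ_ (p u) (just (suc (toℕ a))))
... | a , unused = suc (toℕ a) , (s≤s z≤n , toℕ<n a) , λ u pu≡a → unused (u , pu≡a)

WeightsForced : Graph → Set
WeightsForced G = ∀ (p : PLabel G) → LabelInjective p → DistinctWeights G p

move-exists : ∀ G l (p : PLabel G) → V G ≤ l → WeightsForced G →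
  LabelInjective p → ∀ v → p v ≡ nothing → ∃[ p' ] Move G l p p'
move-exists G l p V≤l forced inj v pv≡nothing
  with free-label p V≤l inj v pv≡nothing
... | a , a∈L , unused =
  assign p v a ,
  v , a , pv≡nothing , a∈L , unused , assign-here p v a , assign-elsewhere p v a ,
  forced (assign p v a)
    (extend-injective p _ v a inj unused (assign-here p v a) (assign-elsewhere p v a))

stuck-is-complete : ∀ G l (p : PLabel G) → V G ≤ l → WeightsForced G →
  LabelInjective p → (∀ p' → ¬ Move G l p p') → ∀ v → ∃[ a ] (p v ≡ just a)
stuck-is-complete G l p V≤l forced inj stuck v with p v in pv
... | just a  = a , refl
... | nothing with move-exists G l p V≤l forced inj v pv
...   | p' , move = ⊥-elim (stuck p' move)

forced-alice-wins : ∀ G l → V G ≤ l → WeightsForced G → AliceAlwaysWins G l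
forced-alice-wins G l V≤l forced p reachable stuck =
  proj₁ ∘ labels , complete-valid-is-ESD G l p valid labels , proj₂ ∘ labels
  where
  valid : Valid G l p
  valid = reachable-valid G l p reachable
  labels : ∀ v → ∃[ a ] (p v ≡ just a)
  labels = stuck-is-complete G l p V≤l forced (proj₁ (proj₂ valid)) stuck

IsCentre : (G : Graph) → Fin (V G) → Set
IsCentre G c =
  (∀ i → proj₁ (edge G i) ≡ c) ×
  (∀ i j → proj₂ (edge G i) ≡ proj₂ (edge G j) → i ≡ j)

-- Two edges through a common centre with equal weights have equal other
-- endpoint labels, so injectivity forces distinct weights.
centre-forces-weights : ∀ G c → IsCentre G c → WeightsForced G
centre-forces-weights G c (starts-at-c , ends-distinct) p inj i j i≢j a b a' b'
  pi₁ pi₂ pj₁ pj₂ equal-weights =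
  i≢j (ends-distinct i j (inj _ _ b pi₂ (trans pj₂ (cong just (sym b≡b')))))
  where
  a≡a' : a ≡ a'
  a≡a' = just-injective (trans (sym (trans (cong p (sym (starts-at-c i))) pi₁))
                               (trans (cong p (sym (starts-at-c j))) pj₁))
  b≡b' : b ≡ b'
  b≡b' = +-cancelˡ-≡ a b b' (trans equal-weights (cong (_+ b') (sym a≡a')))

module _ {m : ℕ} where

  spoke : Fin m → Fin (suc m) × Fin (suc m)
  spoke i = zero , suc i

  -- The leaf reached by the spoke at a given position of the list of
  -- spokes to the leaves g 0, g 1, …; it is injective in the position.
  spokeIndex : ∀ {k} (g : Fin k → Fin m) → Fin (length (map spoke (tabulate g))) → Fin k
  spokeIndex {suc k} g zero    = zero
  spokeIndex {suc k} g (suc i) = suc (spokeIndex (g ∘ suc) i)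

  lookup-spokes : ∀ {k} (g : Fin k → Fin m) i →
    lookup (map spoke (tabulate g)) i ≡ spoke (g (spokeIndex g i))
  lookup-spokes {suc k} g zero    = refl
  lookup-spokes {suc k} g (suc i) = lookup-spokes (g ∘ suc) i

  spokeIndex-injective : ∀ {k} (g : Fin k → Fin m) i j → spokeIndex g i ≡ spokeIndex g j → i ≡ j
  spokeIndex-injective {suc k} g zero    zero    _ = refl
  spokeIndex-injective {suc k} g (suc i) (suc j) e =
    cong suc (spokeIndex-injective (g ∘ suc) i j (Fin-suc-injective e))

star-centre : ∀ m → IsCentre (star (suc m)) zero
star-centre m =
  (λ i → cong proj₁ (lookup-spokes id i)) ,
  (λ i j same-leaf → spokeIndex-injective id i j (Fin-suc-injective
     (trans (cong proj₂ (sym (lookup-spokes id i)))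
            (trans same-leaf (cong proj₂ (lookup-spokes id j))))))

-- S_n has n vertices and is played with n labels; n = 0 is excluded by 2 ≤ n.
theorem11 : ∀ n → 2 ≤ n → AliceAlwaysWins (star n) n
theorem11 (suc m) _ =
  forced-alice-wins (star (suc m)) (suc m) ≤-refl
    (centre-forces-weights (star (suc m)) zero (star-centre m))
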